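{- Let $2\le k<g$ be integers. Suppose that in $Y(g,k)$ a node $[r,s]$ directly precedes, by an edge labeled $(a,b)$, a node $[t,t]$ that has a self-loop labeled $(c,c)$. Then $[r,s]$ is an odd pivot node if and only if $0\le a+b-c\le g-1$, and if it is an odd pivot node then the edge from $[r,s]$ to $[s,r]$ is labeled $(a+b-c,a+b-c)$.
   Context: For integers $2\le k<g$, the labeled directed graph $H(g,k)$ has a distinguished starting node $[[0,0]]$ and other nodes labeled by pairs $[R,r]$ of integers with $0\le R,r\le k-1$ (the node $[0,0]$ is distinct from the starting node). For a node $[P,p]$ (the starting node treated as $[0,0]$ here) there is an edge labeled $(A,a)$ from $[P,p]$ to $[R,r]$ whenever $0\le A,a\le g-1$ are integers, $0\le R,r\le k-1$, $ka+p=A+rg$ and $kA+R=a+Pg$; edges leaving the starting node additionally require $A\ne0\ne a$; no edge enters the starting node. $H(g,k)$ consists of the starting node and all nodes reachable from it. An even pivot node is a node $[a,a]$; an odd pivot node is a node $[r,s]$ with an edge to $[s,r]$ (including $[a,a]$ with a self-loop); the starting node is not a pivot node. $Y(g,k)$ is obtained from $H(g,k)$ by deleting every node that is not a pivot node and from which no pivot node is reachable, with incident edges. -}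

module Defs where

open import Data.Nat using (ℕ; _+_; _*_; _<_)
open import Data.Integer as ℤ using (ℤ; +_)
open import Data.Product using (Σ; ∃; ∃-syntax; _×_; _,_)
open import Data.Sum using (_⊎_)
open import Data.Empty using (⊥)
open import Data.Unit using (⊤)
open import Relation.Binary.PropositionalEquality using (_≡_; _≢_)
open import Relation.Binary.Construct.Closure.ReflexiveTransitive using (Star)

-- Nodes of H(g,k): the distinguished starting node [[0,0]] and nodes [R,r].
-- (The bounds R,r ≤ k-1 are imposed by the edge relation on targets; every
-- node reachable from the start therefore satisfies them.)
data Node : Set where
  start : Node
  node  : ℕ → ℕ → Node

fstC : Node → ℕ
fstC start      = 0
fstC (node P p) = P

sndC : Node → ℕ
sndC start      = 0
sndC (node P p) = p

StartCond : Node → ℕ → ℕ → Set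
StartCond start      A a = (A ≢ 0) × (a ≢ 0)
StartCond (node _ _) A a = ⊤

Edge : ℕ → ℕ → Node → ℕ → ℕ → Node → Set
Edge g k u A a start      = ⊥
Edge g k u A a (node R r) =
  (A < g) × (a < g) × (R < k) × (r < k) ×
  (k * a + sndC u ≡ A + r * g) × (k * A + R ≡ a + fstC u * g) ×
  StartCond u A a

Step : ℕ → ℕ → Node → Node → Set
Step g k u v = ∃[ A ] ∃[ a ] Edge g k u A a v

Reach : ℕ → ℕ → Node → Node → Set
Reach g k = Star (Step g k)

InH : ℕ → ℕ → Node → Set
InH g k v = Reach g k start v

EvenPivot : Node → Set
EvenPivot start      = ⊥
EvenPivot (node a b) = a ≡ b

OddPivot : ℕ → ℕ → Node → Set
OddPivot g k start      = ⊥
OddPivot g k (node r s) = ∃[ A ] ∃[ a ] Edge g k (node r s) A a (node s r)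

Pivot : ℕ → ℕ → Node → Set
Pivot g k v = EvenPivot v ⊎ OddPivot g k v

InY : ℕ → ℕ → Node → Set
InY g k v = InH g k v × (Pivot g k v ⊎ (∃[ w ] (Reach g k v w × Pivot g k w)))

module Submission where

-- 1. Affine relations add and subtract, and for k ≥ 2 the solution x of
--    Affine k x X Y is unique.
-- 2. An edge [r,s] --(A,A′)--> [s,r] forces A′ = A, and then both edge
--    equations reduce to Affine k A s (r·g); conversely every A < g solving
--    this relation labels such an edge, provided r,s < k.  A self-loop at
--    [t,t] is the special case r = s = t.
-- 3. Summing the equations of [r,s] --(a,b)--> [t,t] gives
--    Affine k (a+b) (s+t) (r·g+t·g), and the loop (c,c) gives
--    Affine k c t (t·g).  Hence an odd-pivot label A satisfies A + c = a + b
--    by uniqueness, and conversely e = a+b−c solves Affine k e s (r·g)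
--    (module BeforeLoop).
-- 4. The integer condition 0 ≤ a+b−c ≤ g−1 is translated into ℕ, and the
--    bounds r,s < k hold for every node of H(g,k) other than the start.
-- The theorem then combines 3 and 4; of the Y(g,k)-hypotheses only the
-- membership of [r,s] in H(g,k) is needed.

open import Defs
open import Data.Nat using (ℕ; suc; _+_; _*_; _≤_; _<_; _∸_; z≤n; s≤s)
import Data.Nat.Properties as ℕ
open import Data.Integer as ℤ using (ℤ; +_; _-_)
import Data.Integer.Properties as ℤ
open import Data.Product using (∃-syntax; _×_; _,_; proj₁; proj₂)
open import Data.Sum using (_⊎_; inj₁; inj₂)
open import Data.Unit using (tt)
open import Function.Bundles using (_⇔_; mk⇔)
open import Relation.Binary.PropositionalEquality
  using (_≡_; refl; sym; trans; cong; cong₂; subst; module ≡-Reasoning)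
open import Relation.Binary.Construct.Closure.ReflexiveTransitive using (ε; _◅_)
open import Data.Nat.Tactic.RingSolver using (solve-∀)

-- The common shape of all edge equations: k·x + X = x + Y.  (A record, so
-- that k, x, X, Y can be inferred from the type.)
record Affine (k x X Y : ℕ) : Set where
  constructor affine
  field equation : k * x + X ≡ x + Y

regroup : ∀ k x y X X′ → k * (x + y) + (X + X′) ≡ (k * x + X) + (k * y + X′)
regroup = solve-∀

regroup₁ : ∀ x y Y Y′ → (x + Y) + (y + Y′) ≡ (x + y) + (Y + Y′)
regroup₁ = solve-∀

regroup-suc : ∀ k z X Y → suc k * z + (X + Y) ≡ (k * z + X) + (z + Y)
regroup-suc = solve-∀

affine-add : ∀ {k x y X X′ Y Y′} →
  Affine k x X Y → Affine k y X′ Y′ → Affine k (x + y) (X + X′) (Y + Y′)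
affine-add {k} {x} {y} {X} {X′} {Y} {Y′} (affine e) (affine e′) = affine (begin
  k * (x + y) + (X + X′)     ≡⟨ regroup k x y X X′ ⟩
  (k * x + X) + (k * y + X′) ≡⟨ cong₂ _+_ e e′ ⟩
  (x + Y) + (y + Y′)         ≡⟨ regroup₁ x y Y Y′ ⟩
  (x + y) + (Y + Y′)         ∎)
  where open ≡-Reasoning

affine-sub : ∀ {k x y X X′ Y Y′} →
  Affine k (x + y) (X + X′) (Y + Y′) → Affine k y X′ Y′ → Affine k x X Y
affine-sub {k} {x} {y} {X} {X′} {Y} {Y′} (affine sum) (affine e′) = affine (
  ℕ.+-cancelʳ-≡ (y + Y′) (k * x + X) (x + Y) (begin
    (k * x + X) + (y + Y′)     ≡⟨ cong (λ z → (k * x + X) + z) e′ ⟨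
    (k * x + X) + (k * y + X′) ≡⟨ regroup k x y X X′ ⟨
    k * (x + y) + (X + X′)     ≡⟨ sum ⟩
    (x + y) + (Y + Y′)         ≡⟨ regroup₁ x y Y Y′ ⟨
    (x + Y) + (y + Y′)         ∎))
  where open ≡-Reasoning

-- For k ≥ 2 an affine relation determines its solution x: it says
-- (k−1)·x + X = Y, and multiplication by k−1 ≠ 0 is injective.
affine-unique : ∀ {k x y X Y} → 2 ≤ k →
  Affine k x X Y → Affine k y X Y → x ≡ y
affine-unique {suc (suc j)} {x} {y} {X} {Y} (s≤s (s≤s z≤n)) (affine ex) (affine ey) =
  ℕ.*-cancelˡ-≡ x y (suc j)
    (ℕ.+-cancelʳ-≡ X (suc j * x) (suc j * y) (trans (solved {suc j} ex) (sym (solved {suc j} ey))))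
  where
  solved : ∀ {m z} → suc m * z + X ≡ z + Y → m * z + X ≡ Y
  solved {m} {z} e = ℕ.+-cancelˡ-≡ z (m * z + X) Y (trans (sym (ℕ.+-assoc z (m * z) X)) e)

edge-affine : ∀ {g k P p A a R r} →
  Edge g k (node P p) A a (node R r) → Affine k (A + a) (p + R) (P * g + r * g)
edge-affine {g} {k} {P} {p} {A} {a} {R} {r} (_ , _ , _ , _ , e₁ , e₂ , _) = affine (begin
  k * (A + a) + (p + R)       ≡⟨ swap-sum k A a p R ⟩
  (k * A + R) + (k * a + p)   ≡⟨ cong₂ _+_ e₂ e₁ ⟩
  (a + P * g) + (A + r * g)   ≡⟨ swap-rhs a (P * g) A (r * g) ⟩
  (A + a) + (P * g + r * g)   ∎)
  where
  open ≡-Reasoning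
  swap-sum : ∀ k A a p R → k * (A + a) + (p + R) ≡ (k * A + R) + (k * a + p)
  swap-sum = solve-∀
  swap-rhs : ∀ a Pg A rg → (a + Pg) + (A + rg) ≡ (A + a) + (Pg + rg)
  swap-rhs = solve-∀

-- Subtracting the two edge equations gives (k+1)·A′ = (k+1)·A.
reversal-label : ∀ {g k r s A A′} →
  Edge g k (node r s) A A′ (node s r) → (A′ ≡ A) × Affine k A s (r * g)
reversal-label {g} {k} {r} {s} {A} {A′} (_ , _ , _ , _ , e₁ , e₂ , _) =
  A′≡A , affine (subst (λ z → k * A + s ≡ z + r * g) A′≡A e₂)
  where
  open ≡-Reasoning
  split : ∀ z → suc k * z + (s + r * g) ≡ (k * z + s) + (z + r * g)
  split z = regroup-suc k z s (r * g)
  A′≡A : A′ ≡ A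
  A′≡A = ℕ.*-cancelˡ-≡ A′ A (suc k) (ℕ.+-cancelʳ-≡ (s + r * g) _ _ (begin
    suc k * A′ + (s + r * g)   ≡⟨ split A′ ⟩
    (k * A′ + s) + (A′ + r * g) ≡⟨ cong (_+ (A′ + r * g)) e₁ ⟩
    (A + r * g) + (A′ + r * g)  ≡⟨ ℕ.+-comm (A + r * g) (A′ + r * g) ⟩
    (A′ + r * g) + (A + r * g)  ≡⟨ cong (_+ (A + r * g)) e₂ ⟨
    (k * A + s) + (A + r * g)   ≡⟨ split A ⟨
    suc k * A + (s + r * g)     ∎))

reversal-edge : ∀ {g k r s A} → A < g → s < k → r < k →
  Affine k A s (r * g) → Edge g k (node r s) A A (node s r)
reversal-edge A<g s<k r<k (affine e) = A<g , A<g , s<k , r<k , e , e , tt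

step-bounds : ∀ {g k u R r} → Step g k u (node R r) → R < k × r < k
step-bounds (_ , _ , _ , _ , R<k , r<k , _) = R<k , r<k

reach-bounds : ∀ {g k u R r} → Reach g k u (node R r) → u ≡ node R r ⊎ (R < k × r < k)
reach-bounds ε = inj₁ refl
reach-bounds (step ◅ rest) with reach-bounds rest
... | inj₂ bounds = inj₂ bounds
... | inj₁ refl = inj₂ (step-bounds step)

inH-bounds : ∀ {g k R r} → InH g k (node R r) → R < k × r < k
inH-bounds h with reach-bounds h
... | inj₁ ()
... | inj₂ bounds = bounds

difference-≡ : ∀ {m n e} → e + n ≡ m → + m - + n ≡ + e
difference-≡ {m} {n} {e} refl = begin
  + (e + n) - + n   ≡⟨ ℤ.[+m]-[+n]≡m⊖n (e + n) n ⟩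
  (e + n) ℤ.⊖ n     ≡⟨ ℤ.⊖-≥ (ℕ.m≤n+m n e) ⟩
  + (e + n ∸ n)     ≡⟨ cong +_ (ℕ.m+n∸n≡m e n) ⟩
  + e               ∎
  where open ≡-Reasoning

difference-nonneg : ∀ {m n} → + 0 ℤ.≤ + m - + n → n ≤ m
difference-nonneg 0≤m-n = ℤ.drop‿+≤+ (ℤ.0≤i-j⇒j≤i 0≤m-n)

InRange : ℕ → ℤ → Set
InRange g d = (+ 0 ℤ.≤ d) × (d ℤ.≤ + (g ∸ 1))

difference-in-range : ∀ {g m n e} → e + n ≡ m → e < g → InRange g (+ m - + n)
difference-in-range {suc h} e+n (s≤s e≤h) =
  subst (InRange (suc h)) (sym (difference-≡ e+n)) (ℤ.+≤+ z≤n , ℤ.+≤+ e≤h)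

range-difference : ∀ {g m n} → 0 < g → InRange g (+ m - + n) → ∃[ e ] (e + n ≡ m) × (e < g)
range-difference {suc h} {m} {n} _ (lo , hi) =
  m ∸ n , e+n , s≤s (ℤ.drop‿+≤+ (subst (ℤ._≤ + h) (difference-≡ e+n) hi))
  where
  e+n : m ∸ n + n ≡ m
  e+n = ℕ.m∸n+n≡m (difference-nonneg {n = n} lo)

module BeforeLoop (g k r s t a b c : ℕ)
  (incoming : Edge g k (node r s) a b (node t t))
  (loop : Edge g k (node t t) c c (node t t)) where

  total : Affine k (a + b) (s + t) (r * g + t * g)
  total = edge-affine {P = r} incoming

  loop-rel : Affine k c t (t * g)
  loop-rel = proj₂ (reversal-label loop)

  odd-label : 2 ≤ k → ∀ {A A′} → Edge g k (node r s) A A′ (node s r) →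
    (A′ ≡ A) × (A + c ≡ a + b)
  odd-label 2≤k e with reversal-label e
  ... | A′≡A , rel = A′≡A , affine-unique 2≤k (affine-add rel loop-rel) total

  odd-edge : ∀ {e} → r < k → s < k → e < g → e + c ≡ a + b →
    Edge g k (node r s) e e (node s r)
  odd-edge r<k s<k e<g e+c = reversal-edge e<g s<k r<k
    (affine-sub (subst (λ x → Affine k x (s + t) (r * g + t * g)) (sym e+c) total) loop-rel)

proposition1 : (g k : ℕ) → 2 ≤ k → k < g →
    (r s t a b c : ℕ) →
    InY g k (node r s) → InY g k (node t t) →
    Edge g k (node r s) a b (node t t) →
    Edge g k (node t t) c c (node t t) →
    (OddPivot g k (node r s) ⇔
      ((+ 0 ℤ.≤ (+ a ℤ.+ + b) - + c) × ((+ a ℤ.+ + b) - + c ℤ.≤ + (g ∸ 1))))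
    × (OddPivot g k (node r s) →
      ∃[ e ] ((+ e ≡ (+ a ℤ.+ + b) - + c)
        × Edge g k (node r s) e e (node s r)
        × ((A a′ : ℕ) → Edge g k (node r s) A a′ (node s r) → (A ≡ e) × (a′ ≡ e))))
proposition1 g k 2≤k k<g r s t a b c (inH-rs , _) _ incoming loop =
  mk⇔ in-range from-range , canonical
  where
  open BeforeLoop g k r s t a b c incoming loop
  0<g : 0 < g
  0<g = ℕ.≤-trans (s≤s z≤n) k<g

  in-range : OddPivot g k (node r s) → InRange g (+ (a + b) - + c)
  in-range (A , _ , e@(A<g , _)) = difference-in-range (proj₂ (odd-label 2≤k e)) A<g

  from-range : InRange g (+ (a + b) - + c) → OddPivot g k (node r s)
  from-range range with range-difference 0<g range | inH-bounds inH-rs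
  ... | e , e+c , e<g | r<k , s<k = e , e , odd-edge r<k s<k e<g e+c

  -- the label is a + b − c, and any two odd-pivot labels agree by cancelling c
  canonical : OddPivot g k (node r s) → ∃[ e ] ((+ e ≡ + (a + b) - + c)
    × Edge g k (node r s) e e (node s r)
    × ((A a′ : ℕ) → Edge g k (node r s) A a′ (node s r) → (A ≡ e) × (a′ ≡ e)))
  canonical (A , A′ , e) with odd-label 2≤k e
  ... | A′≡A , A+c = A , sym (difference-≡ A+c) ,
    subst (λ x → Edge g k (node r s) A x (node s r)) A′≡A e , same-label
    where
    same-label : (B B′ : ℕ) → Edge g k (node r s) B B′ (node s r) → (B ≡ A) × (B′ ≡ A)
    same-label B B′ e′ with odd-label 2≤k e′
    ... | B′≡B , B+c = let B≡A = ℕ.+-cancelʳ-≡ c B A (trans B+c (sym A+c)) in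
      B≡A , trans B′≡B B≡A
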